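{- Consider the Star of David board with its 6 gourds and one empty cell. Starting from any configuration, in every configuration reachable by a sequence of slide, turn and pivot moves, each gourd occupies one of only three possible positions (pairs of cells).
   Context: Cells of the regular hexagonal tiling are adjacent if they share a side. The board graph of a board is the graph on its cells with edges between adjacent cells. The Star of David board has 13 cells: - a central cell $c$; - its six neighbors $r_1,\dots,r_6$ in cyclic order; - six further cells $s_1,\dots,s_6$, where $s_i$ is the cell adjacent to both $r_i$ and $r_{i+1}$ (indices mod 6) other than $c$. Its board graph consists of a central hexagon of triangles together with six outer triangles. A configuration is a placement of the 6 gourds (pieces each covering two adjacent cells) on pairwise disjoint pairs of adjacent cells, leaving exactly one empty cell $e$. Suppose a gourd has ends $a$ on cell $p$ and $b$ on cell $q$. The moves are: - Slide: $p,q,e$ are consecutive cells along a straight line of the grid. The gourd moves to $a$ on $q$, $b$ on $e$. - Turn: $q$ is adjacent to both $p$ and $e$, and the centers of $p,q,e$ form a $120^\circ$ angle at $q$. The gourd moves to $a$ on $q$, $b$ on $e$. - Pivot: $e$ is adjacent to both $p$ and $q$. One end stays fixed and the other moves to $e$, giving either $a$ on $p$, $b$ on $e$, or $a$ on $e$, $b$ on $q$. -}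

module Defs where

open import Data.Fin using (Fin; zero; suc)
open import Data.Integer using (ℤ; +_; -[1+_]; _+_; _-_)
open import Data.Product using (_×_; _,_; proj₁; proj₂; ∃; Σ)
open import Data.Sum using (_⊎_)
open import Data.List using (List; _∷_; [])
open import Data.List.Membership.Propositional using (_∈_)
open import Data.Vec using (Vec; lookup; _[_]≔_)
open import Relation.Binary.PropositionalEquality using (_≡_; _≢_)
open import Relation.Nullary using (¬_)
open import Relation.Binary.Construct.Closure.ReflexiveTransitive using (Star)

-- Axial hexagonal coordinates
Vec2 : Set
Vec2 = ℤ × ℤ

_⊕_ : Vec2 → Vec2 → Vec2
(a , b) ⊕ (c , d) = (a + c , b + d)

_⊖_ : Vec2 → Vec2 → Vec2
(a , b) ⊖ (c , d) = (a - c , b - d)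

-- The six unit directions of the hexagonal grid, in cyclic order
-- (consecutive directions make a 60 degree angle).
dir : Fin 6 → Vec2
dir zero                               = (+ 1 , + 0)
dir (suc zero)                         = (+ 1 , -[1+ 0 ])
dir (suc (suc zero))                   = (+ 0 , -[1+ 0 ])
dir (suc (suc (suc zero)))             = (-[1+ 0 ] , + 0)
dir (suc (suc (suc (suc zero))))       = (-[1+ 0 ] , + 1)
dir (suc (suc (suc (suc (suc zero))))) = (+ 0 , + 1)

next : Fin 6 → Fin 6
next zero                               = suc zero
next (suc zero)                         = suc (suc zero)
next (suc (suc zero))                   = suc (suc (suc zero))
next (suc (suc (suc zero)))             = suc (suc (suc (suc zero)))
next (suc (suc (suc (suc zero))))       = suc (suc (suc (suc (suc zero))))
next (suc (suc (suc (suc (suc zero))))) = zero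

units : List Vec2
units = dir zero ∷ dir (suc zero) ∷ dir (suc (suc zero)) ∷ dir (suc (suc (suc zero)))
      ∷ dir (suc (suc (suc (suc zero)))) ∷ dir (suc (suc (suc (suc (suc zero))))) ∷ []

IsUnit : Vec2 → Set
IsUnit v = v ∈ units

-- The 13 cells of the Star of David board:
-- c, r i (i = 0..5, cyclic), s i = the cell adjacent to r i and r (i+1) other than c.
data Cell : Set where
  c : Cell
  r : Fin 6 → Cell
  s : Fin 6 → Cell

coord : Cell → Vec2
coord c     = (+ 0 , + 0)
coord (r i) = dir i
coord (s i) = dir i ⊕ dir (next i)

Adj : Cell → Cell → Set
Adj p q = IsUnit (coord q ⊖ coord p)

-- Move geometry. A gourd with end a on p and end b on q, empty cell e;
-- Move p q e p' q' means the move puts a on p' and b on q'.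
data Move (p q e : Cell) : Cell → Cell → Set where
  slide  : Adj p q → Adj q e → coord q ⊖ coord p ≡ coord e ⊖ coord q → Move p q e q e
  turn   : Adj p q → Adj q e → IsUnit ((coord p ⊖ coord q) ⊕ (coord e ⊖ coord q)) → Move p q e q e
  pivotˡ : Adj e p → Adj e q → Move p q e p e
  pivotʳ : Adj e p → Adj e q → Move p q e e q

Config : Set
Config = Vec (Cell × Cell) 6

Covers : Cell × Cell → Cell → Set
Covers (a , b) x = (a ≡ x) ⊎ (b ≡ x)

EmptyCell : Config → Cell → Set
EmptyCell C e = ¬ (∃ λ g → Covers (lookup C g) e)

Disjoint : Cell × Cell → Cell × Cell → Set
Disjoint P Q = ∀ x → Covers P x → ¬ Covers Q x

-- Valid configuration: each gourd lies on two adjacent cells, gourds pairwise disjoint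
-- (so 12 cells are covered and exactly one of the 13 cells is empty).
Valid : Config → Set
Valid C = (∀ g → Adj (proj₁ (lookup C g)) (proj₂ (lookup C g)))
        × (∀ g h → g ≢ h → Disjoint (lookup C g) (lookup C h))

-- One move: some gourd g, in either labelling of its two ends, moves into the empty cell.
data Step (C : Config) : Config → Set where
  step   : ∀ g e p q p' q' → EmptyCell C e → lookup C g ≡ (p , q) → Move p q e p' q'
         → Step C (C [ g ]≔ (p' , q'))
  step-flip : ∀ g e p q p' q' → EmptyCell C e → lookup C g ≡ (q , p) → Move p q e p' q'
         → Step C (C [ g ]≔ (q' , p'))

Reachable : Config → Config → Set
Reachable = Star Step

SamePos : Cell × Cell → Cell × Cell → Set
SamePos (a , b) (x , y) = ((a ≡ x) × (b ≡ y)) ⊎ ((a ≡ y) × (b ≡ x))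

-- The cells off the ring r₀ … r₅ (the centre c and the tips s₀ … s₅) are pairwise
-- non-adjacent, so every gourd covers a ring cell. Six gourds then cover the six ring
-- cells exactly once each, and the empty cell is never on the ring. A move keeps one
-- end of a gourd and puts the other into the empty cell, adjacent to the kept end;
-- since the empty cell is off the ring, the kept end is the gourd's ring cell rᵢ.
-- So every gourd stays on rᵢ together with one of its neighbours off the ring,
-- which are c, sᵢ and sᵢ₋₁.
module Submission where

open import Defs
open import Data.Fin using (Fin; zero; suc; punchOut)
open import Data.Fin.Properties using (all?; any?; punchOut-injective; injective⇒≤)
  renaming (_≟_ to _≟ᶠ_)
open import Data.Integer using (+_; -_; _+_; _-_)
open import Data.Integer.Properties using (neg-distrib-+; neg-involutive; +-comm; +-inverseʳ)
  renaming (_≟_ to _≟ℤ_)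
import Data.Nat as ℕ
open import Data.Nat.Properties using (1+n≰n)
open import Data.Product using (_×_; _,_; ∃; proj₁; proj₂)
open import Data.Product.Properties using (≡-dec)
open import Data.Sum using (_⊎_; inj₁; inj₂)
open import Data.Vec using (lookup; _[_]≔_)
open import Data.Vec.Properties using (lookup∘update; lookup∘update′)
open import Data.List.Relation.Unary.Any using (here; there)
open import Data.List.Membership.DecPropositional (≡-dec _≟ℤ_ _≟ℤ_) using (_∈?_)
open import Data.Empty using (⊥-elim)
open import Function.Definitions using (Injective)
open import Relation.Nullary using (¬_; Dec; yes; no; contradiction)
open import Relation.Nullary.Decidable using (¬?; _⊎-dec_; _→-dec_; from-yes; from-no)
open import Relation.Binary.PropositionalEquality
  using (_≡_; _≢_; refl; sym; cong; cong₂; subst; module ≡-Reasoning)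
open import Relation.Binary.Construct.Closure.ReflexiveTransitive using (ε; _◅_)

injective⇒surjective : ∀ {n} {f : Fin n → Fin n} → Injective _≡_ _≡_ f → ∀ j → ∃ λ i → f i ≡ j
injective⇒surjective {ℕ.suc m} {f} f-inj j with any? (λ i → f i ≟ᶠ j)
... | yes found = found
... | no missed = contradiction (injective⇒≤ squeeze-injective) 1+n≰n
  where
  missed-at : ∀ i → j ≢ f i
  missed-at i j≡fi = missed (i , sym j≡fi)

  squeeze : Fin (ℕ.suc m) → Fin m
  squeeze i = punchOut (missed-at i)

  squeeze-injective : Injective _≡_ _≡_ squeeze
  squeeze-injective {i} {i′} eq = f-inj (punchOut-injective (missed-at i) (missed-at i′) eq)

minus-anticomm : ∀ a b → a - b ≡ - (b - a)
minus-anticomm a b = sym (begin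
  - (b + - a)   ≡⟨ neg-distrib-+ b (- a) ⟩
  - b + - - a   ≡⟨ cong (_+_ (- b)) (neg-involutive a) ⟩
  - b + a       ≡⟨ +-comm (- b) a ⟩
  a - b         ∎)
  where open ≡-Reasoning

negate : Vec2 → Vec2
negate (a , b) = (- a , - b)

⊖-anticomm : ∀ u v → u ⊖ v ≡ negate (v ⊖ u)
⊖-anticomm (a , b) (a′ , b′) = cong₂ _,_ (minus-anticomm a a′) (minus-anticomm b b′)

negate-unit : ∀ {v} → IsUnit v → IsUnit (negate v)
negate-unit (here refl)                                         = there (there (there (here refl)))
negate-unit (there (here refl))                                 = there (there (there (there (here refl))))
negate-unit (there (there (here refl)))                         = there (there (there (there (there (here refl)))))
negate-unit (there (there (there (here refl))))                 = here refl
negate-unit (there (there (there (there (here refl)))))         = there (here refl)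
negate-unit (there (there (there (there (there (here refl)))))) = there (there (here refl))

adj-sym : ∀ p q → Adj p q → Adj q p
adj-sym p q p∼q = subst IsUnit (sym (⊖-anticomm (coord p) (coord q))) (negate-unit p∼q)

adj-irrefl : ∀ p → ¬ Adj p p
adj-irrefl p p∼p = from-no ((+ 0 , + 0) ∈? units) (subst IsUnit (⊖-self (coord p)) p∼p)
  where
  ⊖-self : ∀ u → u ⊖ u ≡ (+ 0 , + 0)
  ⊖-self (a , b) = cong₂ _,_ (+-inverseʳ a) (+-inverseʳ b)

adj? : ∀ p q → Dec (Adj p q)
adj? p q = (coord q ⊖ coord p) ∈? units

data NonRing : Cell → Set where
  centre : NonRing c
  tip    : ∀ j → NonRing (s j)

ring-or-nonRing : ∀ x → (∃ λ j → x ≡ r j) ⊎ NonRing x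
ring-or-nonRing c     = inj₂ centre
ring-or-nonRing (r j) = inj₁ (j , refl)
ring-or-nonRing (s j) = inj₂ (tip j)

nonRing-independent : ∀ {x y} → NonRing x → NonRing y → ¬ Adj x y
nonRing-independent centre   centre   = adj-irrefl c
nonRing-independent centre   (tip k)  = centre≁tip k
  where
  centre≁tip : ∀ k → ¬ Adj c (s k)
  centre≁tip = from-yes (all? λ k → ¬? (adj? c (s k)))
nonRing-independent (tip j)  centre   = λ sⱼ∼c → nonRing-independent centre (tip j) (adj-sym (s j) c sⱼ∼c)
nonRing-independent (tip j)  (tip k)  = tip≁tip j k
  where
  tip≁tip : ∀ j k → ¬ Adj (s j) (s k)
  tip≁tip = from-yes (all? λ j → all? λ k → ¬? (adj? (s j) (s k)))

prev : Fin 6 → Fin 6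
prev zero                               = suc (suc (suc (suc (suc zero))))
prev (suc zero)                         = zero
prev (suc (suc zero))                   = suc zero
prev (suc (suc (suc zero)))             = suc (suc zero)
prev (suc (suc (suc (suc zero))))       = suc (suc (suc zero))
prev (suc (suc (suc (suc (suc zero))))) = suc (suc (suc (suc zero)))

ring-adjacent-tip : ∀ i k → Adj (r i) (s k) → k ≡ i ⊎ k ≡ prev i
ring-adjacent-tip = from-yes (all? λ i → all? λ k → adj? (r i) (s k) →-dec (k ≟ᶠ i ⊎-dec k ≟ᶠ prev i))

nonRing-neighbours-of-ring : ∀ {i x} → NonRing x → Adj (r i) x → x ≡ c ⊎ x ≡ s i ⊎ x ≡ s (prev i)
nonRing-neighbours-of-ring centre _ = inj₁ refl
nonRing-neighbours-of-ring {i} (tip k) rᵢ∼sₖ with ring-adjacent-tip i k rᵢ∼sₖ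
... | inj₁ refl = inj₂ (inj₁ refl)
... | inj₂ refl = inj₂ (inj₂ refl)

Spoke : Fin 6 → Cell × Cell → Set
Spoke i P = ∃ λ x → NonRing x × Adj (r i) x × SamePos P (r i , x)

spoke-covers-ring : ∀ {i} P → Spoke i P → Covers P (r i)
spoke-covers-ring _ (_ , _ , _ , inj₁ (refl , _)) = inj₁ refl
spoke-covers-ring _ (_ , _ , _ , inj₂ (_ , refl)) = inj₂ refl

spoke-swap : ∀ {i a b} → Spoke i (a , b) → Spoke i (b , a)
spoke-swap (x , x-off , rᵢ∼x , inj₁ (a≡rᵢ , b≡x)) = x , x-off , rᵢ∼x , inj₂ (b≡x , a≡rᵢ)
spoke-swap (x , x-off , rᵢ∼x , inj₂ (a≡x , b≡rᵢ)) = x , x-off , rᵢ∼x , inj₁ (b≡rᵢ , a≡x)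

spoke-end-next-to-nonRing : ∀ {i k e} P → Spoke i P → Covers P k → NonRing e → Adj k e → k ≡ r i
spoke-end-next-to-nonRing _ (_ , _ , _ , inj₁ (refl , _)) (inj₁ refl) _ _ = refl
spoke-end-next-to-nonRing _ (_ , x-off , _ , inj₁ (_ , refl)) (inj₂ refl) e-off x∼e =
  ⊥-elim (nonRing-independent x-off e-off x∼e)
spoke-end-next-to-nonRing _ (_ , x-off , _ , inj₂ (refl , _)) (inj₁ refl) e-off x∼e =
  ⊥-elim (nonRing-independent x-off e-off x∼e)
spoke-end-next-to-nonRing _ (_ , _ , _ , inj₂ (_ , refl)) (inj₂ refl) _ _ = refl

move-keeps-an-end : ∀ {p q e p′ q′} → Move p q e p′ q′ →
  ∃ λ k → Covers (p , q) k × Adj k e × SamePos (p′ , q′) (k , e)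
move-keeps-an-end {q = q} (slide _ q∼e _) = q , inj₂ refl , q∼e , inj₁ (refl , refl)
move-keeps-an-end {q = q} (turn _ q∼e _)  = q , inj₂ refl , q∼e , inj₁ (refl , refl)
move-keeps-an-end {p = p} {e = e} (pivotˡ e∼p _) = p , inj₁ refl , adj-sym e p e∼p , inj₁ (refl , refl)
move-keeps-an-end {q = q} {e = e} (pivotʳ _ e∼q) = q , inj₂ refl , adj-sym e q e∼q , inj₂ (refl , refl)

move-spoke : ∀ {i p q e p′ q′} → Spoke i (p , q) → NonRing e → Move p q e p′ q′ → Spoke i (p′ , q′)
move-spoke {e = e} spoke e-off mv with move-keeps-an-end mv
... | k , k∈pq , k∼e , new with spoke-end-next-to-nonRing _ spoke k∈pq e-off k∼e
... | refl = e , e-off , k∼e , new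

Spokes : (Fin 6 → Fin 6) → Config → Set
Spokes σ D = ∀ h → Spoke (σ h) (lookup D h)

module _ {σ : Fin 6 → Fin 6} (σ-onto : ∀ j → ∃ λ h → σ h ≡ j) where

  empty-nonRing : ∀ {D e} → Spokes σ D → EmptyCell D e → NonRing e
  empty-nonRing {D} {e} spokes e-empty with ring-or-nonRing e
  ... | inj₂ e-off = e-off
  ... | inj₁ (j , refl) with σ-onto j
  ...   | h , refl = ⊥-elim (e-empty (h , spoke-covers-ring (lookup D h) (spokes h)))

  update-spokes : ∀ {D g P} → Spokes σ D → Spoke (σ g) P → Spokes σ (D [ g ]≔ P)
  update-spokes {D} {g} {P} spokes spoke h with g ≟ᶠ h
  ... | yes refl = subst (Spoke (σ g)) (sym (lookup∘update g D P)) spoke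
  ... | no g≢h   = subst (Spoke (σ h)) (sym (lookup∘update′ (λ h≡g → g≢h (sym h≡g)) D P)) (spokes h)

  step-spokes : ∀ {D D′} → Step D D′ → Spokes σ D → Spokes σ D′
  step-spokes {D} (step g _ _ _ _ _ e-empty refl mv) spokes =
    update-spokes {D} spokes (move-spoke (spokes g) (empty-nonRing {D} spokes e-empty) mv)
  step-spokes {D} (step-flip g _ _ _ _ _ e-empty refl mv) spokes =
    update-spokes {D} spokes
      (spoke-swap (move-spoke (spoke-swap (spokes g)) (empty-nonRing {D} spokes e-empty) mv))

  reachable-spokes : ∀ {C D} → Reachable C D → Spokes σ C → Spokes σ D
  reachable-spokes ε              spokes = spokes
  reachable-spokes (first ◅ rest) spokes = reachable-spokes rest (step-spokes first spokes)

edge-covers-ring : ∀ P → Adj (proj₁ P) (proj₂ P) → ∃ λ j → Covers P (r j)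
edge-covers-ring (a , b) a∼b with ring-or-nonRing a | ring-or-nonRing b
... | inj₁ (j , refl) | _               = j , inj₁ refl
... | inj₂ _          | inj₁ (j , refl) = j , inj₂ refl
... | inj₂ a-off      | inj₂ b-off      = ⊥-elim (nonRing-independent a-off b-off a∼b)

edge-with-one-ring-end : ∀ {i} P → Adj (proj₁ P) (proj₂ P) → Covers P (r i) →
  (∀ k → Covers P (r k) → k ≡ i) → Spoke i P
edge-with-one-ring-end (_ , b) a∼b (inj₁ refl) only-i with ring-or-nonRing b
... | inj₂ b-off      = b , b-off , a∼b , inj₁ (refl , refl)
... | inj₁ (k , refl) with only-i k (inj₂ refl)
...   | refl = ⊥-elim (adj-irrefl (r k) a∼b)
edge-with-one-ring-end {i} (a , _) a∼b (inj₂ refl) only-i with ring-or-nonRing a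
... | inj₂ a-off      = a , a-off , adj-sym a (r i) a∼b , inj₂ (refl , refl)
... | inj₁ (k , refl) with only-i k (inj₁ refl)
...   | refl = ⊥-elim (adj-irrefl (r k) a∼b)

valid-spokes : ∀ C → Valid C → ∃ λ σ → (∀ j → ∃ λ h → σ h ≡ j) × Spokes σ C
valid-spokes C (adjacent , disjoint) =
  σ , σ-onto , λ h → edge-with-one-ring-end (lookup C h) (adjacent h) (ring-end h) (only-ring-end h)
  where
  σ : Fin 6 → Fin 6
  σ h = proj₁ (edge-covers-ring (lookup C h) (adjacent h))

  ring-end : ∀ h → Covers (lookup C h) (r (σ h))
  ring-end h = proj₂ (edge-covers-ring (lookup C h) (adjacent h))

  same-gourd : ∀ {h h′ x} → Covers (lookup C h) x → Covers (lookup C h′) x → h ≡ h′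
  same-gourd {h} {h′} {x} h∋x h′∋x with h ≟ᶠ h′
  ... | yes h≡h′ = h≡h′
  ... | no h≢h′  = ⊥-elim (disjoint h h′ h≢h′ x h∋x h′∋x)

  σ-injective : Injective _≡_ _≡_ σ
  σ-injective {h} {h′} σh≡σh′ =
    same-gourd (ring-end h) (subst (λ j → Covers (lookup C h′) (r j)) (sym σh≡σh′) (ring-end h′))

  σ-onto : ∀ j → ∃ λ h → σ h ≡ j
  σ-onto = injective⇒surjective σ-injective

  only-ring-end : ∀ h k → Covers (lookup C h) (r k) → k ≡ σ h
  only-ring-end h k h∋rₖ with σ-onto k
  ... | h′ , refl = cong σ (same-gourd (ring-end h′) h∋rₖ)

spoke-positions : ∀ {i} P → Spoke i P →
  SamePos P (r i , c) ⊎ SamePos P (r i , s i) ⊎ SamePos P (r i , s (prev i))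
spoke-positions {i} P (x , x-off , rᵢ∼x , same) with nonRing-neighbours-of-ring {i} x-off rᵢ∼x
... | inj₁ refl        = inj₁ same
... | inj₂ (inj₁ refl) = inj₂ (inj₁ same)
... | inj₂ (inj₂ refl) = inj₂ (inj₂ same)

mainTheorem3 : (C : Config) → Valid C → (g : Fin 6) →
    ∃ λ (P₁ : Cell × Cell) → ∃ λ (P₂ : Cell × Cell) → ∃ λ (P₃ : Cell × Cell) →
      (D : Config) → Reachable C D →
        SamePos (lookup D g) P₁ ⊎ SamePos (lookup D g) P₂ ⊎ SamePos (lookup D g) P₃
mainTheorem3 C valid g with valid-spokes C valid
... | σ , σ-onto , spokes =
  (r (σ g) , c) , (r (σ g) , s (σ g)) , (r (σ g) , s (prev (σ g))) ,
  λ D C↝D → spoke-positions (lookup D g) (reachable-spokes σ-onto C↝D spokes g)
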